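{- For every integer $k\geq 1$, $\alpha(k)\geq \beta(k)$.
   Context: For a finite family $\mathcal{S}=\{S_1,\dots,S_t\}$ of finite sets, $\mathbf{ID}(\mathcal{S})=2^{S_1}\cup\cdots\cup 2^{S_t}$ (all sets contained in some member of $\mathcal{S}$). For a positive integer $k$, $\alpha(k)$ is the minimum of $|\mathcal{S}|$ over all finite families $\mathcal{S}$ of finite sets with $|\mathbf{ID}(\mathcal{S})|=k$. A DNF (resp. CNF) formula is a disjunction of terms (resp. conjunction of clauses) over a finite set of Boolean variables, and its satisfying assignments are counted among all truth assignments to this variable set (which may include variables not occurring in the formula). $\beta(k)$ is the minimum number of terms or clauses of a DNF or CNF formula having exactly $k$ satisfying assignments. -}

module Defs where

open import Data.Bool using (Bool; true; false)
open import Data.Bool.Properties using () renaming (_≟_ to _≟ᵇ_)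
open import Data.Nat using (ℕ; zero; suc)
open import Data.Fin using (Fin)
open import Data.Fin.Subset using (Subset; _⊆_)
open import Data.Fin.Subset.Properties using (_⊆?_)
open import Data.Vec using (Vec; []; _∷_; lookup)
open import Data.List using (List; []; _∷_; length; filter; map; _++_)
open import Data.List.Relation.Unary.Any using (Any; any?)
open import Data.List.Relation.Unary.All using (All; all?)
open import Data.Product using (_×_; _,_)
open import Relation.Binary.PropositionalEquality using (_≡_)
open import Relation.Nullary using (Dec)

-- All 2^n vectors of Booleans of length n (= all subsets of Fin n,
-- = all truth assignments to n variables), without repetition.
allVecs : (n : ℕ) → List (Vec Bool n)
allVecs zero    = [] ∷ []
allVecs (suc n) = map (false ∷_) (allVecs n) ++ map (true ∷_) (allVecs n)

-- Set families.  A finite family of finite sets is modelled as a list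
-- (without repetitions) of subsets of a finite ground set Fin n.

InID : ∀ {n} → List (Subset n) → Subset n → Set
InID 𝒮 T = Any (T ⊆_) 𝒮

inID? : ∀ {n} (𝒮 : List (Subset n)) (T : Subset n) → Dec (InID 𝒮 T)
inID? 𝒮 T = any? (T ⊆?_) 𝒮

sizeID : ∀ {n} → List (Subset n) → ℕ
sizeID {n} 𝒮 = length (filter (inID? 𝒮) (allVecs n))

-- Formulas over the variables Fin m.
-- A literal is a variable with a polarity (true = positive, false = negated).
Literal : ℕ → Set
Literal m = Fin m × Bool

-- A term (for DNF) or clause (for CNF) is a list of literals;
-- a formula is a list of terms / clauses.
Formula : ℕ → Set
Formula m = List (List (Literal m))

Assignment : ℕ → Set
Assignment m = Vec Bool m

LitSat : ∀ {m} → Assignment m → Literal m → Set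
LitSat a (i , b) = lookup a i ≡ b

litSat? : ∀ {m} (a : Assignment m) (l : Literal m) → Dec (LitSat a l)
litSat? a (i , b) = lookup a i ≟ᵇ b

DNFSat : ∀ {m} → Formula m → Assignment m → Set
DNFSat φ a = Any (All (LitSat a)) φ

dnfSat? : ∀ {m} (φ : Formula m) (a : Assignment m) → Dec (DNFSat φ a)
dnfSat? φ a = any? (all? (litSat? a)) φ

CNFSat : ∀ {m} → Formula m → Assignment m → Set
CNFSat φ a = All (Any (LitSat a)) φ

cnfSat? : ∀ {m} (φ : Formula m) (a : Assignment m) → Dec (CNFSat φ a)
cnfSat? φ a = all? (any? (litSat? a)) φ

#DNF : ∀ {m} → Formula m → ℕ
#DNF {m} φ = length (filter (dnfSat? φ) (allVecs m))

#CNF : ∀ {m} → Formula m → ℕ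
#CNF {m} φ = length (filter (cnfSat? φ) (allVecs m))

-- The family 𝒮 is described by the monotone DNF  ⋁_{S ∈ 𝒮} ⋀_{i ∉ S} ¬xᵢ  over
-- the ground set: an assignment, read as a set T, satisfies the term of S exactly
-- when T ⊆ S, so the satisfying assignments are exactly the members of ID(𝒮).
module Submission where

open import Defs
open import Data.Bool using (true; false)
open import Data.Bool.Properties using () renaming (_≟_ to _≟ᵇ_)
open import Data.Nat using (ℕ; _≤_)
open import Data.Nat.Properties using (≤-reflexive)
open import Data.Fin using (Fin)
open import Data.Fin.Subset using (Subset; _⊆_)
open import Data.Vec using (lookup)
open import Data.Vec.Properties using ([]=⇒lookup; lookup⇒[]=)
open import Data.List using (List; length; map; filter; allFin)
open import Data.List.Properties using (length-map; filter-≐)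
open import Data.List.Membership.Propositional using (_∈_)
open import Data.List.Membership.Propositional.Properties
  using (∈-filter⁻; ∈-filter⁺; ∈-map⁻; ∈-map⁺; ∈-allFin)
open import Data.List.Relation.Unary.All as All using (All)
open import Data.List.Relation.Unary.Any as Any using ()
import Data.List.Relation.Unary.Any.Properties as Any
open import Data.List.Relation.Unary.Unique.Propositional using (Unique)
open import Data.Product using (_×_; _,_; ∃-syntax)
open import Data.Sum using (_⊎_; inj₁)
open import Function using (_⇔_; mk⇔; Equivalence)
open import Relation.Binary.PropositionalEquality using (_≡_; refl; sym; trans; cong)

private
  variable
    n : ℕ

⊆⇔outside-reversed : (S T : Subset n) →
  T ⊆ S ⇔ (∀ i → lookup S i ≡ false → lookup T i ≡ false)
⊆⇔outside-reversed S T = mk⇔ to from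
  where
  to : T ⊆ S → ∀ i → lookup S i ≡ false → lookup T i ≡ false
  to T⊆S i i∉S with lookup T i in i∈T?
  ... | false = refl
  ... | true with () ← trans (sym ([]=⇒lookup (T⊆S (lookup⇒[]= i T i∈T?)))) i∉S

  from : (∀ i → lookup S i ≡ false → lookup T i ≡ false) → T ⊆ S
  from outside {i} i∈T with lookup S i in i∈S?
  ... | true  = lookup⇒[]= i S i∈S?
  ... | false with () ← trans (sym ([]=⇒lookup i∈T)) (outside i i∈S?)

absentees : Subset n → List (Fin n)
absentees {n} S = filter (λ i → lookup S i ≟ᵇ false) (allFin n)

absenceTerm : Subset n → List (Literal n)
absenceTerm S = map (_, false) (absentees S)

satisfies-absenceTerm⇔⊆ : (S T : Subset n) → All (LitSat T) (absenceTerm S) ⇔ T ⊆ S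
satisfies-absenceTerm⇔⊆ {n} S T = mk⇔ to from
  where
  open Equivalence (⊆⇔outside-reversed S T) renaming (to to outside⁺; from to outside⁻)

  to : All (LitSat T) (absenceTerm S) → T ⊆ S
  to sat = outside⁻ λ i i∉S →
    All.lookup sat (∈-map⁺ (_, false) (∈-filter⁺ (λ i → lookup S i ≟ᵇ false) (∈-allFin i) i∉S))

  from : T ⊆ S → All (LitSat T) (absenceTerm S)
  from T⊆S = All.tabulate satisfied
    where
    satisfied : ∀ {l} → l ∈ absenceTerm S → LitSat T l
    satisfied l∈ with ∈-map⁻ (_, false) l∈
    ... | i , i∈absentees , refl
        with _ , i∉S ← ∈-filter⁻ (λ i → lookup S i ≟ᵇ false) {xs = allFin n} i∈absentees
        = outside⁺ T⊆S i i∉S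

downClosureDNF : List (Subset n) → Formula n
downClosureDNF = map absenceTerm

satisfies-downClosureDNF⇔InID : (𝒮 : List (Subset n)) (T : Subset n) →
  DNFSat (downClosureDNF 𝒮) T ⇔ InID 𝒮 T
satisfies-downClosureDNF⇔InID 𝒮 T = mk⇔
  (λ sat → Any.map (λ {S} → Equivalence.to (satisfies-absenceTerm⇔⊆ S T)) (Any.map⁻ sat))
  (λ T∈ID → Any.map⁺ (Any.map (λ {S} → Equivalence.from (satisfies-absenceTerm⇔⊆ S T)) T∈ID))

#DNF-downClosureDNF≡sizeID : (𝒮 : List (Subset n)) → #DNF (downClosureDNF 𝒮) ≡ sizeID 𝒮
#DNF-downClosureDNF≡sizeID {n} 𝒮 = cong length
  (filter-≐ (dnfSat? (downClosureDNF 𝒮)) (inID? 𝒮)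
    ((λ {T} → Equivalence.to (satisfies-downClosureDNF⇔InID 𝒮 T))
    , (λ {T} → Equivalence.from (satisfies-downClosureDNF⇔InID 𝒮 T)))
    (allVecs n))

corollary9 : (k : ℕ) → 1 ≤ k →
    (n : ℕ) (𝒮 : List (Subset n)) → Unique 𝒮 → sizeID 𝒮 ≡ k →
    ∃[ m ] ∃[ φ ] (length {A = List (Literal m)} φ ≤ length 𝒮 × (#DNF {m} φ ≡ k ⊎ #CNF {m} φ ≡ k))
corollary9 k _ n 𝒮 _ |ID𝒮|≡k =
  n , downClosureDNF 𝒮 ,
  ≤-reflexive (length-map absenceTerm 𝒮) ,
  inj₁ (trans (#DNF-downClosureDNF≡sizeID 𝒮) |ID𝒮|≡k)
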